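{- Let $X$ be a finite nonempty set of keys, $\Sigma$ a set, $q\in\mathbb{N}$ with $q\ge 1$, $m\in\mathbb{N}$, let $\mathcal{H}=\{h_x:\Sigma\to[2^q]\}_{x\in X}$ be any family of functions, and let $\sigma:\{0,\dots,q-1\}\times\{0,\dots,m\}\to\Sigma$ be injective. Define $\tilde f(x,2^r)$ for $x\in X$ and $r\in\{0,\dots,q\}$ as follows: $a= h_x(\sigma(0,0))\bmod 2^r$; $b=\lfloor\log_2 a\rfloor$ if $a>0$ and $b=0$ otherwise; $c=h_x(\sigma(b,0))\bmod 2^b$; $\tilde f(x,2^r)=a\oplus c$. Then $\tilde f$ is monotone: for all $x\in X$ and all $r,r'\in\{0,\dots,q\}$ with $r<r'$, if $\tilde f(x,2^{r'})<2^r$ then $\tilde f(x,2^{r'})=\tilde f(x,2^r)$.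
   Context: $[N]=\{0,1,\dots,N-1\}$. $\oplus$ denotes bitwise exclusive-or of nonnegative integers in binary. Note $\tilde f(x,2^r)\in[2^r]$. -}

module Defs where

open import Data.Nat using (ℕ; zero; suc; _+_; _*_; _^_; _∸_; _≤_; _<_; z≤n; s≤s; z<s; ⌊_/2⌋; NonZero; _≡ᵇ_)
open import Data.Nat.Properties
open import Data.Nat.DivMod using (_%_; _/_; m%n<n)
open import Data.Nat.Logarithm using (⌊log₂_⌋; ⌊log₂[2^n]⌋≡n; ⌊log₂⌊n/2⌋⌋≡⌊log₂n⌋∸1)
open import Data.Bool using (Bool; true; false; _xor_)
open import Data.Fin using (Fin; toℕ; fromℕ<)
open import Data.Product using (_×_; _,_)
open import Relation.Nullary using (contradiction)
open import Relation.Binary.PropositionalEquality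

-- The fuel argument is only a termination device: fuel a + b is always
-- enough, since both arguments are halved at every step.

bit : ℕ → Bool
bit n = (n % 2) ≡ᵇ 1

bitToℕ : Bool → ℕ
bitToℕ true  = 1
bitToℕ false = 0

xorFuel : ℕ → ℕ → ℕ → ℕ
xorFuel zero    a b = 0
xorFuel (suc k) a b = bitToℕ (bit a xor bit b) + 2 * xorFuel k (a / 2) (b / 2)

infixl 6 _⊕_
_⊕_ : ℕ → ℕ → ℕ
a ⊕ b = xorFuel (a + b) a b

half< : ∀ n m → n < m + m → ⌊ n /2⌋ < m
half< zero          (suc m) _ = z<s
half< (suc zero)    (suc m) _ = z<s
half< (suc (suc n)) (suc m) (s≤s p) =
  s≤s (half< n m (≤-pred (subst (suc (suc n) ≤_) (+-suc m m) p)))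

log₂< : ∀ q a → 1 ≤ a → a < 2 ^ q → ⌊log₂ a ⌋ < q
log₂< zero a 1≤a a<1 = contradiction a<1 (≤⇒≯ 1≤a)
log₂< (suc q) (suc zero) _ _ = subst (_< suc q) (sym (⌊log₂[2^n]⌋≡n 0)) z<s
log₂< (suc q) (suc (suc a)) _ lt =
  step (subst (_< q) (⌊log₂⌊n/2⌋⌋≡⌊log₂n⌋∸1 (suc (suc a)))
         (log₂< q ⌊ suc (suc a) /2⌋ (s≤s z≤n)
           (half< (suc (suc a)) (2 ^ q)
             (subst (suc (suc a) <_) (cong (2 ^ q +_) (+-identityʳ (2 ^ q))) lt))))
  where
  step : ∀ {x} → x ∸ 1 < q → x < suc q
  step {zero}  _ = z<s
  step {suc x} p = s≤s p

_mod2^_ : ℕ → ℕ → ℕ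
v mod2^ r = _%_ v (2 ^ r) {{m^n≢0 2 r}}

mod2^<2^q : ∀ {q r} (v : ℕ) → r ≤ q → v mod2^ r < 2 ^ q
mod2^<2^q {q} {r} v r≤q = <-≤-trans (m%n<n v (2 ^ r) {{m^n≢0 2 r}}) (^-monoʳ-≤ 2 r≤q)

bIndex : ∀ {q} → 1 ≤ q → (a : ℕ) → a < 2 ^ q → Fin q
bIndex q≥1 zero    _   = fromℕ< q≥1
bIndex {q} q≥1 (suc a) lt  = fromℕ< (log₂< q (suc a) (s≤s z≤n) lt)

ftilde : ∀ {n : ℕ} {Sig : Set} (q m : ℕ) → 1 ≤ q →
         (h : Fin n → Sig → Fin (2 ^ q)) →
         (σ : Fin q × Fin (suc m) → Sig) →
         Fin n → (r : ℕ) → r ≤ q → ℕ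
ftilde q m q≥1 h σ x r r≤q = a ⊕ c
  where
  a : ℕ
  a = toℕ (h x (σ (fromℕ< q≥1 , Fin.zero))) mod2^ r
  b : Fin q
  b = bIndex q≥1 a (mod2^<2^q (toℕ (h x (σ (fromℕ< q≥1 , Fin.zero)))) r≤q)
  c : ℕ
  c = toℕ (h x (σ (b , Fin.zero))) mod2^ toℕ b

-- Xoring a with any c below the leading bit 2^⌊log₂ a⌋ of a keeps that bit, so
-- f̃(x, 2^r′) < 2^r forces a = h_x(σ(0,0)) mod 2^r′ < 2^r.  Then reducing modulo
-- 2^r does not change a, and f̃(x, 2^r) is computed from the same a, hence the
-- same b and c.
module Submission where

open import Defs
open import Data.Nat using (ℕ; zero; suc; _+_; _*_; _^_; _≤_; _<_; z≤n; s≤s; z<s; ⌊_/2⌋)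
open import Data.Nat.Properties
open import Data.Nat.DivMod using (_/_; m%n<n; m*n/n≡m; /-monoˡ-≤; m<n*o⇒m/o<n; m<n⇒m%n≡m; m∣n⇒o%n%m≡o%m)
open import Data.Nat.Divisibility using (_∣_; m∣m*n)
open import Data.Nat.Induction using (<-rec)
open import Data.Nat.Logarithm using (⌊log₂_⌋)
open import Data.Nat.Logarithm.Core using (⌊log2⌋-acc-irrelevant)
open import Data.Bool using (_xor_)
open import Data.Fin using (Fin; toℕ; fromℕ<)
open import Data.Fin.Properties using (toℕ-fromℕ<)
open import Data.Product using (_×_; _,_)
open import Function.Definitions using (Injective)
open import Relation.Binary.PropositionalEquality

n<2^n : ∀ n → n < 2 ^ n
n<2^n zero    = z<s
n<2^n (suc n) = begin-strict
  suc n          ≤⟨ n<2^n n ⟩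
  2 ^ n          <⟨ m<m+n (2 ^ n) (m^n>0 2 n) ⟩
  2 ^ n + 2 ^ n  ≡⟨ cong (2 ^ n +_) (sym (+-identityʳ (2 ^ n))) ⟩
  2 ^ suc n      ∎
  where open ≤-Reasoning

2^m<2^n⇒m<n : ∀ {m n} → 2 ^ m < 2 ^ n → m < n
2^m<2^n⇒m<n lt = ≰⇒> (λ n≤m → <⇒≱ lt (^-monoʳ-≤ 2 n≤m))

m^n∣m^o : ∀ m {n o} → n ≤ o → m ^ n ∣ m ^ o
m^n∣m^o m {n} {o} n≤o =
  subst (m ^ n ∣_) (trans (sym (^-distribˡ-+-* m n _)) (cong (m ^_) (m+[n∸m]≡n n≤o)))
    (m∣m*n _)

2*⌊n/2⌋≤n : ∀ n → 2 * ⌊ n /2⌋ ≤ n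
2*⌊n/2⌋≤n zero          = z≤n
2*⌊n/2⌋≤n (suc zero)    = z≤n
2*⌊n/2⌋≤n (suc (suc n)) =
  subst (_≤ 2 + n) (sym (*-suc 2 ⌊ n /2⌋)) (s≤s (s≤s (2*⌊n/2⌋≤n n)))

n≤1+2*⌊n/2⌋ : ∀ n → n ≤ suc (2 * ⌊ n /2⌋)
n≤1+2*⌊n/2⌋ zero          = z≤n
n≤1+2*⌊n/2⌋ (suc zero)    = s≤s z≤n
n≤1+2*⌊n/2⌋ (suc (suc n)) =
  subst (2 + n ≤_) (cong suc (sym (*-suc 2 ⌊ n /2⌋))) (s≤s (s≤s (n≤1+2*⌊n/2⌋ n)))

⌊log₂[2+n]⌋≡1+⌊log₂⌊[2+n]/2⌋⌋ : ∀ n → ⌊log₂ (2 + n) ⌋ ≡ suc ⌊log₂ ⌊ 2 + n /2⌋ ⌋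
⌊log₂[2+n]⌋≡1+⌊log₂⌊[2+n]/2⌋⌋ n = cong suc (⌊log2⌋-acc-irrelevant (suc ⌊ n /2⌋))

2^⌊log₂n⌋≤n : ∀ n → 1 ≤ n → 2 ^ ⌊log₂ n ⌋ ≤ n
2^⌊log₂n⌋≤n = <-rec _ λ where
    (suc zero)    _   _ → ≤-refl
    (suc (suc n)) rec _ → begin
      2 ^ ⌊log₂ (2 + n) ⌋           ≡⟨ cong (2 ^_) (⌊log₂[2+n]⌋≡1+⌊log₂⌊[2+n]/2⌋⌋ n) ⟩
      2 * 2 ^ ⌊log₂ ⌊ 2 + n /2⌋ ⌋   ≤⟨ *-monoʳ-≤ 2 (rec (⌊n/2⌋<n (suc n)) (s≤s z≤n)) ⟩
      2 * ⌊ 2 + n /2⌋               ≤⟨ 2*⌊n/2⌋≤n (2 + n) ⟩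
      2 + n                         ∎
  where open ≤-Reasoning

n<2^[1+⌊log₂n⌋] : ∀ n → n < 2 ^ suc ⌊log₂ n ⌋
n<2^[1+⌊log₂n⌋] = <-rec _ λ where
    zero          _   → z<s
    (suc zero)    _   → s≤s (s≤s z≤n)
    (suc (suc n)) rec → begin-strict
      2 + n                             ≤⟨ n≤1+2*⌊n/2⌋ (2 + n) ⟩
      suc (2 * ⌊ 2 + n /2⌋)             <⟨ n<1+n _ ⟩
      2 + 2 * ⌊ 2 + n /2⌋               ≡⟨ sym (*-suc 2 ⌊ 2 + n /2⌋) ⟩
      2 * suc ⌊ 2 + n /2⌋               ≤⟨ *-monoʳ-≤ 2 (rec (⌊n/2⌋<n (suc n))) ⟩
      2 * 2 ^ suc ⌊log₂ ⌊ 2 + n /2⌋ ⌋   ≡⟨ cong (λ e → 2 ^ suc e) (sym (⌊log₂[2+n]⌋≡1+⌊log₂⌊[2+n]/2⌋⌋ n)) ⟩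
      2 ^ suc ⌊log₂ (2 + n) ⌋           ∎
  where open ≤-Reasoning

2^[1+e]≤m⇒2^e≤m/2 : ∀ e {m} → 2 ^ suc e ≤ m → 2 ^ e ≤ m / 2
2^[1+e]≤m⇒2^e≤m/2 e {m} le = begin
  2 ^ e          ≡⟨ sym (m*n/n≡m (2 ^ e) 2) ⟩
  2 ^ e * 2 / 2  ≤⟨ /-monoˡ-≤ 2 (subst (_≤ m) (*-comm 2 (2 ^ e)) le) ⟩
  m / 2          ∎
  where open ≤-Reasoning

m<2^[1+e]⇒m/2<2^e : ∀ e {m} → m < 2 ^ suc e → m / 2 < 2 ^ e
m<2^[1+e]⇒m/2<2^e e {m} lt = m<n*o⇒m/o<n (subst (m <_) (*-comm 2 (2 ^ e)) lt)

2^b≤xorFuel : ∀ b {k a c} → b < k → 2 ^ b ≤ a → a < 2 ^ suc b → c < 2 ^ b →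
              2 ^ b ≤ xorFuel k a c
2^b≤xorFuel zero    {suc k} {suc zero}    {zero}  _ _ _ _ = s≤s z≤n
2^b≤xorFuel zero    {suc k} {suc zero}    {suc c} _ _ _ (s≤s ())
2^b≤xorFuel zero    {suc k} {suc (suc a)} _ _ (s≤s (s≤s ())) _
2^b≤xorFuel (suc b) {suc k} {a} {c} (s≤s b<k) lo hi c< = begin
  2 * 2 ^ b                                           ≤⟨ *-monoʳ-≤ 2 halves ⟩
  2 * xorFuel k (a / 2) (c / 2)                       ≤⟨ m≤n+m _ (bitToℕ (bit a xor bit c)) ⟩
  bitToℕ (bit a xor bit c) + 2 * xorFuel k (a / 2) (c / 2) ∎
  where
  open ≤-Reasoning
  halves : 2 ^ b ≤ xorFuel k (a / 2) (c / 2)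
  halves = 2^b≤xorFuel b b<k (2^[1+e]≤m⇒2^e≤m/2 b lo)
             (m<2^[1+e]⇒m/2<2^e (suc b) hi) (m<2^[1+e]⇒m/2<2^e b c<)

2^⌊log₂a⌋≤a⊕c : ∀ a c → 1 ≤ a → c < 2 ^ ⌊log₂ a ⌋ → 2 ^ ⌊log₂ a ⌋ ≤ a ⊕ c
2^⌊log₂a⌋≤a⊕c a c 1≤a c< = 2^b≤xorFuel ⌊log₂ a ⌋ enoughFuel lo (n<2^[1+⌊log₂n⌋] a) c<
  where
  lo : 2 ^ ⌊log₂ a ⌋ ≤ a
  lo = 2^⌊log₂n⌋≤n a 1≤a
  enoughFuel : ⌊log₂ a ⌋ < a + c
  enoughFuel = <-≤-trans (n<2^n ⌊log₂ a ⌋) (≤-trans lo (m≤m+n a c))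

a⊕c<2^r⇒a<2^r : ∀ a c r → c < 2 ^ ⌊log₂ a ⌋ → a ⊕ c < 2 ^ r → a < 2 ^ r
a⊕c<2^r⇒a<2^r zero      c r _  _  = m^n>0 2 r
a⊕c<2^r⇒a<2^r a@(suc _) c r c< lt = <-≤-trans (n<2^[1+⌊log₂n⌋] a) (^-monoʳ-≤ 2 log<r)
  where
  log<r : ⌊log₂ a ⌋ < r
  log<r = 2^m<2^n⇒m<n (≤-<-trans (2^⌊log₂a⌋≤a⊕c a c (s≤s z≤n) c<) lt)

mod2^r′≡mod2^r : ∀ v {r r′} → r ≤ r′ → v mod2^ r′ < 2 ^ r → v mod2^ r′ ≡ v mod2^ r
mod2^r′≡mod2^r v {r} {r′} r≤r′ lt = begin
  v mod2^ r′              ≡⟨ sym (m<n⇒m%n≡m {{m^n≢0 2 r}} lt) ⟩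
  (v mod2^ r′) mod2^ r    ≡⟨ m∣n⇒o%n%m≡o%m (2 ^ r) (2 ^ r′) v {{m^n≢0 2 r}} {{m^n≢0 2 r′}} (m^n∣m^o 2 r≤r′) ⟩
  v mod2^ r               ∎
  where open ≡-Reasoning

-- f̃(x, 2^r) is `xorLowBits a _` for a = h_x(σ(0,0)) mod 2^r and g b = h_x(σ(b,0)).
module _ {q : ℕ} (q≥1 : 1 ≤ q) (g : Fin q → ℕ) where

  xorLowBits : (a : ℕ) → a < 2 ^ q → ℕ
  xorLowBits a a<2^q = a ⊕ (g b mod2^ toℕ b)
    where
    b : Fin q
    b = bIndex q≥1 a a<2^q

  xorLowBits-cong : ∀ {a a′} (p : a < 2 ^ q) (p′ : a′ < 2 ^ q) → a ≡ a′ →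
                    xorLowBits a p ≡ xorLowBits a′ p′
  xorLowBits-cong p p′ refl = cong (xorLowBits _) (≤-irrelevant p p′)

  xorLowBits<2^r⇒a<2^r : ∀ r a (p : a < 2 ^ q) → xorLowBits a p < 2 ^ r → a < 2 ^ r
  xorLowBits<2^r⇒a<2^r r zero      _ _  = m^n>0 2 r
  xorLowBits<2^r⇒a<2^r r a@(suc _) p lt = a⊕c<2^r⇒a<2^r a _ r c<2^⌊log₂a⌋ lt
    where
    b : Fin q
    b = bIndex q≥1 a p
    c<2^⌊log₂a⌋ : g b mod2^ toℕ b < 2 ^ ⌊log₂ a ⌋
    c<2^⌊log₂a⌋ = subst (λ e → g b mod2^ toℕ b < 2 ^ e) (toℕ-fromℕ< (log₂< q a (s≤s z≤n) p))
                    (m%n<n (g b) (2 ^ toℕ b) {{m^n≢0 2 (toℕ b)}})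

theorem2p1 : (n : ℕ) → 1 ≤ n → (Sig : Set) → (q : ℕ) → (q≥1 : 1 ≤ q) → (m : ℕ) →
    (h : Fin n → Sig → Fin (2 ^ q)) →
    (σ : Fin q × Fin (suc m) → Sig) → Injective _≡_ _≡_ σ →
    (x : Fin n) → (r r′ : ℕ) → (r≤q : r ≤ q) → (r′≤q : r′ ≤ q) → r < r′ →
    ftilde q m q≥1 h σ x r′ r′≤q < 2 ^ r →
    ftilde q m q≥1 h σ x r′ r′≤q ≡ ftilde q m q≥1 h σ x r r≤q
theorem2p1 n _ Sig q q≥1 m h σ _ x r r′ r≤q r′≤q r<r′ f̃<2^r =
  xorLowBits-cong q≥1 g (mod2^<2^q v r′≤q) (mod2^<2^q v r≤q)
    (mod2^r′≡mod2^r v (<⇒≤ r<r′) a′<2^r)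
  where
  g : Fin q → ℕ
  g b = toℕ (h x (σ (b , Fin.zero)))
  v : ℕ
  v = g (fromℕ< q≥1)
  a′<2^r : v mod2^ r′ < 2 ^ r
  a′<2^r = xorLowBits<2^r⇒a<2^r q≥1 g r (v mod2^ r′) (mod2^<2^q v r′≤q) f̃<2^r
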